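{- Let $n\ge 1$ and let $A\in M_n(\mathbb{F}_2)$ be a tridiagonal matrix all of whose subdiagonal and superdiagonal entries equal $1$ (diagonal entries arbitrary). Then $A$ has rank $n$ if and only if $e_1$ lies in the column space of $A$, and also $A$ has rank $n$ if and only if $e_n$ lies in the column space of $A$.
   Context: $e_i$ denotes the $i$-th standard basis vector of $\mathbb{F}_2^n$. -}

module Defs where

open import Data.Bool using (Bool; true; false; _xor_; _∧_)
open import Data.Nat using (ℕ; suc; _+_; _≤_)
open import Data.Fin using (Fin; toℕ; zero; fromℕ)
open import Data.Product using (∃; _×_)
open import Relation.Nullary using (yes; no)
open import Data.Fin using (_≟_)
open import Relation.Binary.PropositionalEquality using (_≡_)

-- The field F₂ is modelled by Bool: addition = xor, multiplication = ∧.
-- n×n matrices over F₂ as functions; A i j is the entry in row i, column j.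
Mat : ℕ → Set
Mat n = Fin n → Fin n → Bool

Vector : ℕ → Set
Vector n = Fin n → Bool

sumF2 : ∀ {n} → (Fin n → Bool) → Bool
sumF2 {ℕ.zero} f = false
sumF2 {suc n} f = f zero xor sumF2 (λ i → f (Data.Fin.suc i))

_·_ : ∀ {n} → Mat n → Vector n → Vector n
(A · x) i = sumF2 (λ j → A i j ∧ x j)

zeroVec : ∀ {n} → Vector n
zeroVec _ = false

InColumnSpace : ∀ {n} → Mat n → Vector n → Set
InColumnSpace A b = ∃ λ x → ∀ i → (A · x) i ≡ b i

-- rank A = n: the n columns of A are linearly independent over F₂
-- (the column space has dimension n).
RankFull : ∀ {n} → Mat n → Set
RankFull A = ∀ x → (∀ i → (A · x) i ≡ false) → ∀ j → x j ≡ false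

TridiagOnes : ∀ {n} → Mat n → Set
TridiagOnes {n} A = ∀ (i j : Fin n) →
  (suc (toℕ i) ≡ toℕ j → A i j ≡ true) × (suc (toℕ j) ≡ toℕ i → A i j ≡ true)
  × (suc (suc (toℕ i)) ≤ toℕ j → A i j ≡ false) × (suc (suc (toℕ j)) ≤ toℕ i → A i j ≡ false)

-- standard basis vector e_i (here indexed by Fin n, so e₁ is index zero)
basis : ∀ {n} → Fin n → Vector n
basis i j with i ≟ j
... | yes _ = true
... | no _ = false

-- Writing d for the diagonal, the rows of A x = 0 other than the last one form the
-- recurrence x₍ₜ₊₁₎ = x₍ₜ₋₁₎ + dₜ xₜ, so a vector killed by them is determined by x₀:
-- it is x₀ times the continuant vector K with K₀ = 1.  The last row of A K is the
-- continuant K₍ₙ₎ = det A, and every other row of A K vanishes; hence A K = det A · eₙ.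
-- So A has full rank iff det A = 1 iff eₙ is in the column space.  The statement
-- for e₁ follows by applying this to the reversed matrix A (n+1-i, n+1-j), which is
-- again tridiagonal with unit off-diagonals.
module Submission where

open import Defs
open import Data.Nat using (ℕ; suc)
open import Data.Fin using (zero; fromℕ)
open import Data.Product using (_×_)
open import Function.Bundles using (_⇔_)

open import Algebra.Bundles using (CommutativeMonoid)
open import Data.Bool using (Bool; true; false; _xor_; _∧_)
open import Data.Bool.Properties
  using (xor-assoc; xor-comm; xor-same; xor-identityʳ; ∧-zeroʳ; ∧-identityʳ;
         ∧-conicalʳ; ∧-distribˡ-xor; ∧-commutativeMonoid; ¬-not)
open import Data.Fin using (Fin; suc; toℕ; fromℕ<; inject₁; opposite; _≟_)
open import Data.Fin.Properties
  using (toℕ<n; toℕ≤pred[n]; toℕ-fromℕ; toℕ-fromℕ<; toℕ-inject₁; fromℕ≢inject₁;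
         opposite-prop; opposite-involutive)
open import Data.Fin.Relation.Unary.Top using (view; ‵fromℕ; ‵inject₁)
open import Data.Nat using (zero; _+_; _∸_; _≤_; _<_; z≤n; s≤s)
open import Data.Nat.Properties
  using (≤-refl; ≤-trans; n≤1+n; <⇒≤; +-monoʳ-≤; ∸-monoʳ-≤; +-∸-assoc; [m+n]∸[m+o]≡n∸o)
open import Data.Empty using (⊥-elim)
open import Data.Product using (_,_; proj₂)
open import Function using (_∘_)
open import Function.Bundles using (mk⇔)
import Function.Properties.Equivalence as ⇔
open import Relation.Nullary using (yes; no)
open import Relation.Binary.PropositionalEquality
  using (_≡_; _≢_; refl; sym; trans; cong; cong₂; subst; subst₂; module ≡-Reasoning)
open import Algebra.Properties.CommutativeSemigroup
  (CommutativeMonoid.commutativeSemigroup ∧-commutativeMonoid) using (x∙yz≈y∙xz)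

open ≡-Reasoning

xor≡false⇒≡ : ∀ a b → a xor b ≡ false → b ≡ a
xor≡false⇒≡ false false _ = refl
xor≡false⇒≡ true  true  _ = refl

sumF2-cong : ∀ {n} {f g : Fin n → Bool} → (∀ j → f j ≡ g j) → sumF2 f ≡ sumF2 g
sumF2-cong {zero}  f≗g = refl
sumF2-cong {suc n} f≗g = cong₂ _xor_ (f≗g zero) (sumF2-cong (f≗g ∘ suc))

sumF2-zero : ∀ {n} {f : Fin n → Bool} → (∀ j → f j ≡ false) → sumF2 f ≡ false
sumF2-zero {zero}  f≡0 = refl
sumF2-zero {suc n} f≡0 = cong₂ _xor_ (f≡0 zero) (sumF2-zero (f≡0 ∘ suc))

sumF2-∧ˡ : ∀ {n} a (f : Fin n → Bool) → sumF2 (λ j → a ∧ f j) ≡ a ∧ sumF2 f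
sumF2-∧ˡ {zero}  a f = sym (∧-zeroʳ a)
sumF2-∧ˡ {suc n} a f = trans (cong (a ∧ f zero xor_) (sumF2-∧ˡ a (f ∘ suc)))
                             (sym (∧-distribˡ-xor a (f zero) (sumF2 (f ∘ suc))))

sumF2-last : ∀ {n} (f : Fin (suc n) → Bool) → sumF2 f ≡ sumF2 (f ∘ inject₁) xor f (fromℕ n)
sumF2-last {zero}  f = xor-identityʳ (f zero)
sumF2-last {suc n} f = trans (cong (f zero xor_) (sumF2-last (f ∘ suc)))
                             (sym (xor-assoc (f zero) _ _))

sumF2-opposite : ∀ {n} (f : Fin n → Bool) → sumF2 f ≡ sumF2 (f ∘ opposite)
sumF2-opposite {zero}  f = refl
sumF2-opposite {suc n} f = begin
  sumF2 f                                        ≡⟨ sumF2-last f ⟩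
  sumF2 (f ∘ inject₁) xor f (fromℕ n)            ≡⟨ cong (_xor f (fromℕ n)) (sumF2-opposite (f ∘ inject₁)) ⟩
  sumF2 (f ∘ inject₁ ∘ opposite) xor f (fromℕ n) ≡⟨ xor-comm _ (f (fromℕ n)) ⟩
  sumF2 (f ∘ opposite)                           ∎

·-cong : ∀ {n} (A : Mat n) {x y : Vector n} → (∀ j → x j ≡ y j) → ∀ i → (A · x) i ≡ (A · y) i
·-cong A x≗y i = sumF2-cong (λ j → cong (A i j ∧_) (x≗y j))

·-∧ˡ : ∀ {n} (A : Mat n) a (x : Vector n) i → (A · (λ j → a ∧ x j)) i ≡ a ∧ (A · x) i
·-∧ˡ A a x i = trans (sumF2-cong (λ j → x∙yz≈y∙xz (A i j) a (x j))) (sumF2-∧ˡ a (λ j → A i j ∧ x j))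

basis-diag : ∀ {n} (i : Fin n) → basis i i ≡ true
basis-diag i with i ≟ i
... | yes _   = refl
... | no  i≢i = ⊥-elim (i≢i refl)

basis-offdiag : ∀ {n} {i j : Fin n} → i ≢ j → basis i j ≡ false
basis-offdiag {i = i} {j} i≢j with i ≟ j
... | yes i≡j = ⊥-elim (i≢j i≡j)
... | no  _   = refl

basis-opposite : ∀ {n} (i j : Fin n) → basis (opposite i) j ≡ basis i (opposite j)
basis-opposite i j with opposite i ≟ j | i ≟ opposite j
... | yes _    | yes _    = refl
... | no  _    | no  _    = refl
... | yes ōi≡j | no  i≢ōj = ⊥-elim (i≢ōj (trans (sym (opposite-involutive i)) (cong opposite ōi≡j)))
... | no  ōi≢j | yes i≡ōj = ⊥-elim (ōi≢j (trans (cong opposite i≡ōj) (opposite-involutive j)))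

-- Extending vectors by zeros makes the first and last rows of A three-term rows like the others.
pad : ∀ {n} → Vector n → ℕ → Bool
pad {zero}  x k       = false
pad {suc n} x zero    = x zero
pad {suc n} x (suc k) = pad (x ∘ suc) k

pad-toℕ : ∀ {n} (x : Vector n) j → pad x (toℕ j) ≡ x j
pad-toℕ x zero    = refl
pad-toℕ x (suc j) = pad-toℕ (x ∘ suc) j

pad-cong-at : ∀ {n} {x y : Vector n} k → (∀ j → toℕ j ≡ k → x j ≡ y j) → pad x k ≡ pad y k
pad-cong-at {zero}  k       x≡y = refl
pad-cong-at {suc n} zero    x≡y = x≡y zero refl
pad-cong-at {suc n} (suc k) x≡y = pad-cong-at k (λ j e → x≡y (suc j) (cong suc e))

pad-tabulate : ∀ {n} (g : ℕ → Bool) {k} → k < n → pad {n} (g ∘ toℕ) k ≡ g k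
pad-tabulate g {zero}  (s≤s _)   = refl
pad-tabulate g {suc k} (s≤s k<n) = pad-tabulate (g ∘ suc) k<n

pad-beyond : ∀ {n} (x : Vector n) {k} → n ≤ k → pad x k ≡ false
pad-beyond {zero}  x _         = refl
pad-beyond {suc n} x (s≤s n≤k) = pad-beyond (x ∘ suc) n≤k

prev : (ℕ → Bool) → ℕ → Bool
prev X zero    = false
prev X (suc t) = X t

sumF2-window : ∀ {n} (f : Vector n) t →
  (∀ j → suc (suc (toℕ j)) ≤ t → f j ≡ false) → (∀ j → suc (suc t) ≤ toℕ j → f j ≡ false) →
  sumF2 f ≡ prev (pad f) t xor pad f t xor pad f (suc t)
sumF2-window {zero}        f zero          below above = refl
sumF2-window {zero}        f (suc t)       below above = refl
sumF2-window {suc zero}    f zero          below above = refl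
sumF2-window {suc (suc n)} f zero          below above =
  cong (f zero xor_) (trans (cong (f (suc zero) xor_) (sumF2-zero (λ j → above (suc (suc j)) (s≤s (s≤s z≤n)))))
                            (xor-identityʳ (f (suc zero))))
sumF2-window {suc n}       f (suc zero)    below above =
  cong (f zero xor_) (sumF2-window (f ∘ suc) zero (λ _ ()) (λ j → above (suc j) ∘ s≤s))
sumF2-window {suc n}       f (suc (suc t)) below above =
  trans (cong (_xor sumF2 (f ∘ suc)) (below zero (s≤s (s≤s z≤n))))
        (sumF2-window (f ∘ suc) (suc t) (λ j → below (suc j) ∘ s≤s) (λ j → above (suc j) ∘ s≤s))

nextTerm : (ℕ → Bool) → (ℕ → Bool) → ℕ → Bool
nextTerm d X t = prev X t xor d t ∧ X t

tridiagRow : (ℕ → Bool) → (ℕ → Bool) → ℕ → Bool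
tridiagRow d X t = nextTerm d X t xor X (suc t)

nextTerm-cong : ∀ d {X Y : ℕ → Bool} t → (∀ k → k ≤ t → X k ≡ Y k) → nextTerm d X t ≡ nextTerm d Y t
nextTerm-cong d zero    X≡Y = cong (d zero ∧_) (X≡Y zero z≤n)
nextTerm-cong d (suc t) X≡Y =
  cong₂ (λ a b → a xor d (suc t) ∧ b) (X≡Y t (n≤1+n t)) (X≡Y (suc t) ≤-refl)

tridiagRow-next : ∀ d X t → tridiagRow d X t ≡ false → X (suc t) ≡ nextTerm d X t
tridiagRow-next d X t = xor≡false⇒≡ (nextTerm d X t) (X (suc t))

continuant : (ℕ → Bool) → ℕ → Bool
continuant d zero          = true
continuant d (suc zero)    = d zero
continuant d (suc (suc t)) = continuant d t xor d (suc t) ∧ continuant d (suc t)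

continuant-suc : ∀ d t → continuant d (suc t) ≡ nextTerm d (continuant d) t
continuant-suc d zero    = sym (∧-identityʳ (d zero))
continuant-suc d (suc t) = refl

tridiagRow-continuant : ∀ d t → tridiagRow d (continuant d) t ≡ false
tridiagRow-continuant d t =
  trans (cong (nextTerm d (continuant d) t xor_) (continuant-suc d t))
        (xor-same (nextTerm d (continuant d) t))

tridiagRow-kernel : ∀ {d X m} → (∀ t → t < m → tridiagRow d X t ≡ false) →
  ∀ k → k ≤ m → X k ≡ X 0 ∧ continuant d k
tridiagRow-kernel {d} {X} {m} rows k k≤m = proj₂ (scaled k k≤m)
  where
  K = continuant d
  factor : ∀ a b c e → (a ∧ b) xor c ∧ (a ∧ e) ≡ a ∧ (b xor c ∧ e)
  factor true  b c e = refl
  factor false b c e = ∧-zeroʳ c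
  scaled : ∀ k → k ≤ m → prev X k ≡ X 0 ∧ prev K k × X k ≡ X 0 ∧ K k
  scaled zero    _   = sym (∧-zeroʳ (X 0)) , sym (∧-identityʳ (X 0))
  scaled (suc k) k<m with scaled k (<⇒≤ k<m)
  ... | prevX , Xk = Xk , (begin
    X (suc k)                             ≡⟨ tridiagRow-next d X k (rows k k<m) ⟩
    prev X k xor d k ∧ X k                ≡⟨ cong₂ (λ a b → a xor d k ∧ b) prevX Xk ⟩
    (X 0 ∧ prev K k) xor d k ∧ (X 0 ∧ K k) ≡⟨ factor (X 0) (prev K k) (d k) (K k) ⟩
    X 0 ∧ nextTerm d K k                  ≡⟨ cong (X 0 ∧_) (continuant-suc d k) ⟨
    X 0 ∧ K (suc k)                       ∎)

module TridiagonalRows {n} (A : Mat n) (T : TridiagOnes A) where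

  diagonal : ℕ → Bool
  diagonal = pad (λ j → A j j)

  ·-tridiagRow : ∀ x i → (A · x) i ≡ tridiagRow diagonal (pad x) (toℕ i)
  ·-tridiagRow x i = begin
      sumF2 entry
    ≡⟨ sumF2-window entry t (λ j → cong (_∧ x j) ∘ farBelow j) (λ j → cong (_∧ x j) ∘ farAbove j) ⟩
      prev (pad entry) t xor pad entry t xor pad entry (suc t)
    ≡⟨ cong₂ _xor_ (neighbourBelow t refl) (cong₂ _xor_ onDiagonal neighbourAbove) ⟩
      prev (pad x) t xor diagonal t ∧ pad x t xor pad x (suc t)
    ≡⟨ xor-assoc (prev (pad x) t) _ _ ⟨
      tridiagRow diagonal (pad x) t
    ∎
    where
    t = toℕ i
    entry : Vector n
    entry j = A i j ∧ x j
    adjacentAbove : ∀ j → suc t ≡ toℕ j → A i j ≡ true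
    adjacentAbove j with T i j
    ... | adjacent , _ = adjacent
    adjacentBelow : ∀ j → suc (toℕ j) ≡ t → A i j ≡ true
    adjacentBelow j with T i j
    ... | _ , adjacent , _ = adjacent
    farAbove : ∀ j → suc (suc t) ≤ toℕ j → A i j ≡ false
    farAbove j with T i j
    ... | _ , _ , far , _ = far
    farBelow : ∀ j → suc (suc (toℕ j)) ≤ t → A i j ≡ false
    farBelow j with T i j
    ... | _ , _ , _ , far = far
    neighbourBelow : ∀ s → s ≡ t → prev (pad entry) s ≡ prev (pad x) s
    neighbourBelow zero    _   = refl
    neighbourBelow (suc s) s≡t = pad-cong-at s λ j j≡s →
      cong (_∧ x j) (adjacentBelow j (trans (cong suc j≡s) s≡t))
    neighbourAbove : pad entry (suc t) ≡ pad x (suc t)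
    neighbourAbove = pad-cong-at (suc t) λ j j≡st → cong (_∧ x j) (adjacentAbove j (sym j≡st))
    onDiagonal : pad entry t ≡ diagonal t ∧ pad x t
    onDiagonal = trans (pad-toℕ entry i) (sym (cong₂ _∧_ (pad-toℕ _ i) (pad-toℕ x i)))

module TridiagonalSquare {m} (A : Mat (suc m)) (T : TridiagOnes A) where
  open TridiagonalRows A T

  -- The continuant of the diagonal, which is det A over F₂.
  det : Bool
  det = continuant diagonal (suc m)

  continuantVector : Vector (suc m)
  continuantVector = continuant diagonal ∘ toℕ

  UpperRowsVanish : Vector (suc m) → Set
  UpperRowsVanish x = ∀ (j : Fin m) → (A · x) (inject₁ j) ≡ false

  pad-continuantVector : ∀ {k} → k ≤ m → pad continuantVector k ≡ continuant diagonal k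
  pad-continuantVector k≤m = pad-tabulate (continuant diagonal) (s≤s k≤m)

  ·-continuantVector-upper : ∀ (j : Fin m) → (A · continuantVector) (inject₁ j) ≡ false
  ·-continuantVector-upper j = begin
      (A · continuantVector) (inject₁ j)
    ≡⟨ ·-tridiagRow continuantVector (inject₁ j) ⟩
      tridiagRow diagonal (pad continuantVector) t
    ≡⟨ cong₂ _xor_ (nextTerm-cong diagonal t (λ k k≤t → pad-continuantVector (≤-trans k≤t (<⇒≤ t<m))))
                   (pad-continuantVector t<m) ⟩
      tridiagRow diagonal (continuant diagonal) t
    ≡⟨ tridiagRow-continuant diagonal t ⟩
      false
    ∎
    where
    t = toℕ (inject₁ j)
    t<m : t < m
    t<m = subst (_< m) (sym (toℕ-inject₁ j)) (toℕ<n j)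

  ·-continuantVector-last : (A · continuantVector) (fromℕ m) ≡ det
  ·-continuantVector-last = begin
      (A · continuantVector) (fromℕ m)
    ≡⟨ ·-tridiagRow continuantVector (fromℕ m) ⟩
      tridiagRow diagonal (pad continuantVector) (toℕ (fromℕ m))
    ≡⟨ cong (tridiagRow diagonal (pad continuantVector)) (toℕ-fromℕ m) ⟩
      nextTerm diagonal (pad continuantVector) m xor pad continuantVector (suc m)
    ≡⟨ cong₂ _xor_ (nextTerm-cong diagonal m (λ _ → pad-continuantVector))
                   (pad-beyond continuantVector ≤-refl) ⟩
      nextTerm diagonal (continuant diagonal) m xor false
    ≡⟨ xor-identityʳ _ ⟩
      nextTerm diagonal (continuant diagonal) m
    ≡⟨ continuant-suc diagonal m ⟨
      det
    ∎

  ·-continuantVector : ∀ i → (A · continuantVector) i ≡ det ∧ basis (fromℕ m) i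
  ·-continuantVector i with view i
  ... | ‵fromℕ = trans ·-continuantVector-last
                       (sym (trans (cong (det ∧_) (basis-diag (fromℕ m))) (∧-identityʳ det)))
  ... | ‵inject₁ j = trans (·-continuantVector-upper j)
                           (sym (trans (cong (det ∧_) (basis-offdiag fromℕ≢inject₁)) (∧-zeroʳ det)))

  upperRowsVanish⇒multiple : ∀ x → UpperRowsVanish x → ∀ j → x j ≡ x zero ∧ continuantVector j
  upperRowsVanish⇒multiple x upper j =
    trans (sym (pad-toℕ x j)) (tridiagRow-kernel rows (toℕ j) (toℕ≤pred[n] j))
    where
    rows : ∀ t → t < m → tridiagRow diagonal (pad x) t ≡ false
    rows t t<m = begin
      tridiagRow diagonal (pad x) t                             ≡⟨ cong (tridiagRow diagonal (pad x)) toℕ-row ⟨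
      tridiagRow diagonal (pad x) (toℕ (inject₁ (fromℕ< t<m)))  ≡⟨ ·-tridiagRow x _ ⟨
      (A · x) (inject₁ (fromℕ< t<m))                            ≡⟨ upper (fromℕ< t<m) ⟩
      false                                                     ∎
      where toℕ-row = trans (toℕ-inject₁ (fromℕ< t<m)) (toℕ-fromℕ< t<m)

  ·-last-of-upperRowsVanish : ∀ x → UpperRowsVanish x → (A · x) (fromℕ m) ≡ x zero ∧ det
  ·-last-of-upperRowsVanish x upper = begin
      (A · x) (fromℕ m)
    ≡⟨ ·-cong A (upperRowsVanish⇒multiple x upper) (fromℕ m) ⟩
      (A · (λ j → x zero ∧ continuantVector j)) (fromℕ m)
    ≡⟨ ·-∧ˡ A (x zero) continuantVector (fromℕ m) ⟩
      x zero ∧ (A · continuantVector) (fromℕ m)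
    ≡⟨ cong (x zero ∧_) ·-continuantVector-last ⟩
      x zero ∧ det
    ∎

  rankFull⇔det : RankFull A ⇔ (det ≡ true)
  rankFull⇔det = mk⇔ to from
    where
    to : RankFull A → det ≡ true
    to full = ¬-not λ det≡false →
      true≢false (full continuantVector
        (λ i → trans (·-continuantVector i) (cong (_∧ basis (fromℕ m) i) det≡false)) zero)
      where true≢false : true ≢ false
            true≢false ()
    from : det ≡ true → RankFull A
    from det≡true x Ax≡0 j = trans (upperRowsVanish⇒multiple x upper j) (cong (_∧ continuantVector j) x₀≡false)
      where
      upper : UpperRowsVanish x
      upper = Ax≡0 ∘ inject₁
      x₀≡false : x zero ≡ false
      x₀≡false = begin
        x zero              ≡⟨ ∧-identityʳ (x zero) ⟨
        x zero ∧ true       ≡⟨ cong (x zero ∧_) det≡true ⟨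
        x zero ∧ det        ≡⟨ ·-last-of-upperRowsVanish x upper ⟨
        (A · x) (fromℕ m)   ≡⟨ Ax≡0 (fromℕ m) ⟩
        false               ∎

  lastBasisInColumnSpace⇔det : InColumnSpace A (basis (fromℕ m)) ⇔ (det ≡ true)
  lastBasisInColumnSpace⇔det = mk⇔ to from
    where
    to : InColumnSpace A (basis (fromℕ m)) → det ≡ true
    to (y , Ay≡e) = ∧-conicalʳ (y zero) det (begin
      y zero ∧ det              ≡⟨ ·-last-of-upperRowsVanish y upper ⟨
      (A · y) (fromℕ m)         ≡⟨ Ay≡e (fromℕ m) ⟩
      basis (fromℕ m) (fromℕ m) ≡⟨ basis-diag (fromℕ m) ⟩
      true                      ∎)
      where
      upper : UpperRowsVanish y
      upper j = trans (Ay≡e (inject₁ j)) (basis-offdiag fromℕ≢inject₁)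
    from : det ≡ true → InColumnSpace A (basis (fromℕ m))
    from det≡true = continuantVector ,
      λ i → trans (·-continuantVector i) (cong (_∧ basis (fromℕ m) i) det≡true)

rankFull⇔lastBasisInColumnSpace : ∀ {m} (A : Mat (suc m)) → TridiagOnes A →
  RankFull A ⇔ InColumnSpace A (basis (fromℕ m))
rankFull⇔lastBasisInColumnSpace A T = ⇔.trans rankFull⇔det (⇔.sym lastBasisInColumnSpace⇔det)
  where open TridiagonalSquare A T

reverse : ∀ {n} → Mat n → Mat n
reverse A i j = A (opposite i) (opposite j)

∸-shift : ∀ k a {m} → k + a ≤ m → k + (m ∸ (k + a)) ≡ m ∸ a
∸-shift k a {m} k+a≤m = trans (sym (+-∸-assoc k k+a≤m)) ([m+n]∸[m+o]≡n∸o k m a)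

opposite-adjacent : ∀ {n} (i j : Fin n) → suc (toℕ i) ≡ toℕ j →
  suc (toℕ (opposite j)) ≡ toℕ (opposite i)
opposite-adjacent {n} i j si≡j = begin
  suc (toℕ (opposite j))       ≡⟨ cong suc (opposite-prop j) ⟩
  suc (n ∸ suc (toℕ j))        ≡⟨ cong (λ b → suc (n ∸ suc b)) si≡j ⟨
  suc (n ∸ suc (suc (toℕ i)))  ≡⟨ ∸-shift 1 (suc (toℕ i)) (subst (λ b → suc b ≤ n) (sym si≡j) (toℕ<n j)) ⟩
  n ∸ suc (toℕ i)              ≡⟨ opposite-prop i ⟨
  toℕ (opposite i)             ∎

opposite-far : ∀ {n} (i j : Fin n) → suc (suc (toℕ i)) ≤ toℕ j →
  suc (suc (toℕ (opposite j))) ≤ toℕ (opposite i)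
opposite-far {n} i j far =
  subst₂ _≤_ (cong (2 +_) (sym (opposite-prop j)))
             (trans (∸-shift 2 (suc (toℕ i)) (≤-trans (s≤s far) (toℕ<n j))) (sym (opposite-prop i)))
             (+-monoʳ-≤ 2 (∸-monoʳ-≤ n (s≤s far)))

TridiagOnes-reverse : ∀ {n} {A : Mat n} → TridiagOnes A → TridiagOnes (reverse A)
TridiagOnes-reverse T i j with T (opposite i) (opposite j)
... | above , below , farAbove , farBelow =
  below ∘ opposite-adjacent i j , above ∘ opposite-adjacent j i ,
  farBelow ∘ opposite-far i j , farAbove ∘ opposite-far j i

reverse-·-opposite : ∀ {n} (A : Mat n) x i → (reverse A · (x ∘ opposite)) i ≡ (A · x) (opposite i)
reverse-·-opposite A x i = sym (sumF2-opposite (λ j → A (opposite i) j ∧ x j))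

·-opposite : ∀ {n} (A : Mat n) x i → (A · (x ∘ opposite)) i ≡ (reverse A · x) (opposite i)
·-opposite A x i = begin
  (A · (x ∘ opposite)) i                              ≡⟨ cong (A · (x ∘ opposite)) (opposite-involutive i) ⟨
  (A · (x ∘ opposite)) (opposite (opposite i))        ≡⟨ reverse-·-opposite A (x ∘ opposite) (opposite i) ⟨
  (reverse A · (x ∘ opposite ∘ opposite)) (opposite i) ≡⟨ ·-cong (reverse A) (cong x ∘ opposite-involutive) (opposite i) ⟩
  (reverse A · x) (opposite i)                        ∎

RankFull-conj : ∀ {n} {B C : Mat n} → (∀ x i → (B · (x ∘ opposite)) i ≡ (C · x) (opposite i)) →
  RankFull B → RankFull C
RankFull-conj B≈C full x Cx≡0 j =
  trans (cong x (sym (opposite-involutive j)))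
        (full (x ∘ opposite) (λ i → trans (B≈C x i) (Cx≡0 (opposite i))) (opposite j))

InColumnSpace-conj : ∀ {n} {B C : Mat n} {b c : Vector n} →
  (∀ x i → (B · (x ∘ opposite)) i ≡ (C · x) (opposite i)) → (∀ i → b i ≡ c (opposite i)) →
  InColumnSpace C c → InColumnSpace B b
InColumnSpace-conj B≈C b≡c (x , Cx≡c) =
  x ∘ opposite , λ i → trans (B≈C x i) (trans (Cx≡c (opposite i)) (sym (b≡c i)))

RankFull-reverse : ∀ {n} (A : Mat n) → RankFull A ⇔ RankFull (reverse A)
RankFull-reverse A = mk⇔ (RankFull-conj (·-opposite A)) (RankFull-conj (reverse-·-opposite A))

InColumnSpace-reverse : ∀ {n} (A : Mat n) {b c : Vector n} → (∀ i → c i ≡ b (opposite i)) →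
  InColumnSpace A b ⇔ InColumnSpace (reverse A) c
InColumnSpace-reverse A {b} {c} c≡b = mk⇔
  (InColumnSpace-conj (reverse-·-opposite A) c≡b)
  (InColumnSpace-conj (·-opposite A)
    (λ i → trans (cong b (sym (opposite-involutive i))) (sym (c≡b (opposite i)))))

mainTheorem3 : (m : ℕ) → (A : Mat (suc m)) → TridiagOnes A →
    (RankFull A ⇔ InColumnSpace A (basis zero)) × (RankFull A ⇔ InColumnSpace A (basis (fromℕ m)))
mainTheorem3 m A T = firstBasis , rankFull⇔lastBasisInColumnSpace A T
  where
  firstBasis : RankFull A ⇔ InColumnSpace A (basis zero)
  firstBasis =
    ⇔.trans (RankFull-reverse A)
      (⇔.trans (rankFull⇔lastBasisInColumnSpace (reverse A) (TridiagOnes-reverse T))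
               (⇔.sym (InColumnSpace-reverse A (basis-opposite zero))))
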